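{- Let $T$ be a decomposition tree and $v$ an internal node of $T$ labeled $\oplus$, with left child $v_l$ and right child $v_r$, such that both $v_l$ and $v_r$ have the staircase property. Suppose that $\hat\alpha(v_r)\le\hat\beta(v_l)$, and that neither ($\hat\alpha(v_l)=\hat\beta(v_r)=0$) nor ($\hat\alpha(v_r)=\hat\beta(v_l)=0$) holds. Then $\widehat{\min}(v)=\widehat{\min}(v_l)+\widehat{\min}(v_r)$.
   Context: All graphs are finite, simple and undirected. For a graph $H$ and $S\subseteq V(H)$, $N_H[S]$ is the closed neighbourhood of $S$ in $H$ and $H[S]$ the induced subgraph; a graph with no vertices is regarded as having a (empty) perfect matching. A decomposition tree is a rooted tree $T$ in which every internal node has exactly two children, a left child $v_l$ and a right child $v_r$, and carries one of the labels $\otimes$ (true twin), $\odot$ (false twin), $\oplus$ (attachment). To each node $v$ are associated a graph $\hat G(v)$ and a twin set $\hat{TS}(v)\subseteq V(\hat G(v))$: for a leaf, $\hat G(v)$ is a single vertex $x$ (distinct leaves giving distinct vertices) and $\hat{TS}(v)=\{x\}$; for an internal node $v$, $V(\hat G(v))=V(\hat G(v_l))\cup V(\hat G(v_r))$ and: if $v$ is labeled $\otimes$, $E(\hat G(v))=E(\hat G(v_l))\cup E(\hat G(v_r))\cup\{xy: x\in \hat{TS}(v_l), y\in\hat{TS}(v_r)\}$ and $\hat{TS}(v)=\hat{TS}(v_l)\cup\hat{TS}(v_r)$; if labeled $\odot$, $E(\hat G(v))=E(\hat G(v_l))\cup E(\hat G(v_r))$ and $\hat{TS}(v)=\hat{TS}(v_l)\cup\hat{TS}(v_r)$;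 if labeled $\oplus$, the edge set is as for $\otimes$ and $\hat{TS}(v)=\hat{TS}(v_l)$. For a node $u$ and $0\le k\le|\hat{TS}(u)|$, $\hat\gamma_k(u)$ is the minimum of $|S|$ over all $S\subseteq V(\hat G(u))$ with $V(\hat G(u))\setminus \hat{TS}(u)\subseteq N_{\hat G(u)}[S]$ for which there is $X\subseteq S\cap\hat{TS}(u)$, $|X|=k$, such that $\hat G(u)[S\setminus X]$ has a perfect matching. Let $\widehat{\min}(u)=\min\{\hat\gamma_k(u):0\le k\le|\hat{TS}(u)|\}$, and let $\hat\alpha(u)$ (resp. $\hat\beta(u)$) be the smallest (resp. largest) $k$ with $\hat\gamma_k(u)=\widehat{\min}(u)$. A node $u$ has the staircase property if for every $0\le k\le|\hat{TS}(u)|$: $\hat\gamma_k(u)=\widehat{\min}(u)+\hat\alpha(u)-k$ if $k\le\hat\alpha(u)$; $\hat\gamma_k(u)=\widehat{\min}(u)+k-\hat\beta(u)$ if $k\ge\hat\beta(u)$; $\hat\gamma_k(u)=\widehat{\min}(u)$ if $\hat\alpha(u)<k<\hat\beta(u)$ and $k-\hat\alpha(u)$ is even; and $\hat\gamma_k(u)=\widehat{\min}(u)+1$ otherwise. -}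

module Defs where

open import Data.Nat using (ℕ; zero; suc; _+_; _∸_; _≤_; _<_; _%_)
open import Data.Bool using (Bool; true; false; _∧_; not)
open import Data.List using (List; []; _∷_; map; _++_; filter; length)
open import Data.Product using (Σ; _×_; _,_; ∃)
open import Data.Sum using (_⊎_)
open import Data.Empty using (⊥)
open import Relation.Nullary using (¬_)
open import Relation.Binary.PropositionalEquality using (_≡_)

-- Node labels: ⊗ (true twin), ⊙ (false twin), ⊕ (attachment)
data Label : Set where
  tt⊗ ft⊙ at⊕ : Label

data Tree : Set where
  leaf : Tree
  node : Label → Tree → Tree → Tree

-- Vertices of Ĝ(t): one per leaf of t (distinct leaves give distinct vertices).
data Vtx : Tree → Set where
  here  : Vtx leaf
  left  : ∀ {lab l r} → Vtx l → Vtx (node lab l r)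
  right : ∀ {lab l r} → Vtx r → Vtx (node lab l r)

allV : (t : Tree) → List (Vtx t)
allV leaf = here ∷ []
allV (node lab l r) = map left (allV l) ++ map right (allV r)

TS : (t : Tree) → Vtx t → Bool
TS leaf here = true
TS (node tt⊗ l r) (left x) = TS l x
TS (node tt⊗ l r) (right y) = TS r y
TS (node ft⊙ l r) (left x) = TS l x
TS (node ft⊙ l r) (right y) = TS r y
TS (node at⊕ l r) (left x) = TS l x
TS (node at⊕ l r) (right y) = false

-- Edges between twin sets of the two children (labels ⊗ and ⊕)
Cross : Label → Bool → Bool → Set
Cross tt⊗ a b = a ≡ true × b ≡ true
Cross ft⊙ a b = ⊥
Cross at⊕ a b = a ≡ true × b ≡ true

Adj : (t : Tree) → Vtx t → Vtx t → Set
Adj leaf here here = ⊥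
Adj (node lab l r) (left x) (left y) = Adj l x y
Adj (node lab l r) (right x) (right y) = Adj r x y
Adj (node lab l r) (left x) (right y) = Cross lab (TS l x) (TS r y)
Adj (node lab l r) (right y) (left x) = Cross lab (TS l x) (TS r y)

Subset : Tree → Set
Subset t = Vtx t → Bool

∣_∣ₛ : ∀ {t} → Subset t → ℕ
∣_∣ₛ {t} S = length (filter (λ x → S x Data.Bool.≟ true) (allV t))
  where import Data.Bool

tsSize : Tree → ℕ
tsSize t = ∣ TS t ∣ₛ

InClosedNbhd : (t : Tree) → Subset t → Vtx t → Set
InClosedNbhd t S x = S x ≡ true ⊎ Σ (Vtx t) (λ y → S y ≡ true × Adj t x y)

HasPerfectMatching : (t : Tree) → Subset t → Set
HasPerfectMatching t A =
  Σ (Vtx t → Vtx t → Bool) λ M →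
    (∀ x y → M x y ≡ true → A x ≡ true × A y ≡ true × Adj t x y) ×
    (∀ x y → M x y ≡ true → M y x ≡ true) ×
    (∀ x → A x ≡ true → Σ (Vtx t) λ y → M x y ≡ true × (∀ z → M x z ≡ true → z ≡ y))

Feasible : (t : Tree) → ℕ → Subset t → Set
Feasible t k S =
  (∀ x → TS t x ≡ false → InClosedNbhd t S x) ×
  Σ (Subset t) λ X →
    (∀ x → X x ≡ true → S x ≡ true × TS t x ≡ true) ×
    ∣ X ∣ₛ ≡ k ×
    HasPerfectMatching t (λ x → S x ∧ not (X x))

IsGamma : (t : Tree) → ℕ → ℕ → Set
IsGamma t k m =
  Σ (Subset t) (λ S → Feasible t k S × ∣ S ∣ₛ ≡ m) ×
  (∀ S → Feasible t k S → m ≤ ∣ S ∣ₛ)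

IsMinHat : (t : Tree) → ℕ → Set
IsMinHat t m =
  Σ ℕ (λ k → k ≤ tsSize t × IsGamma t k m) ×
  (∀ k m' → k ≤ tsSize t → IsGamma t k m' → m ≤ m')

IsAlpha : (t : Tree) → ℕ → ℕ → Set
IsAlpha t mn a = a ≤ tsSize t × IsGamma t a mn × (∀ k → k < a → ¬ IsGamma t k mn)

IsBeta : (t : Tree) → ℕ → ℕ → Set
IsBeta t mn b = b ≤ tsSize t × IsGamma t b mn ×
  (∀ k → b < k → k ≤ tsSize t → ¬ IsGamma t k mn)

Staircase : Tree → Set
Staircase t =
  Σ ℕ λ mn → Σ ℕ λ a → Σ ℕ λ b →
    IsMinHat t mn × IsAlpha t mn a × IsBeta t mn b ×
    (∀ k → k ≤ tsSize t →
      (k ≤ a → IsGamma t k (mn + (a ∸ k))) ×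
      (b ≤ k → IsGamma t k (mn + (k ∸ b))) ×
      (a < k → k < b → (k ∸ a) % 2 ≡ 0 → IsGamma t k mn) ×
      (a < k → k < b → ¬ ((k ∸ a) % 2 ≡ 0) → IsGamma t k (suc mn)))

{-# OPTIONS --safe #-}

-- A feasible set S of the ⊕-node splits along the two children: a matching edge of Ĝ(v)[S ∖ X]
-- crossing between them joins a twin of l to a twin of r, so declaring both endpoints unmatched
-- leaves feasible sets for l and r, whence |S| ≥ min̂(l) + min̂(r).
-- Conversely, glue optimal sets for γ̂_β̂(l)(l) and γ̂_α̂(r)(r). Every twin of l is adjacent to
-- every twin of r, so since α̂(r) ≤ β̂(l) the α̂(r) unmatched twins of r can be matched to distinct
-- unmatched twins of l; and since β̂(l) > 0, a twin of l in the set dominates T̂S(r), which is not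
-- part of the twin set of v.
-- The staircase property of the children is used only to know that every γ̂_k is attained, which
-- is what lets the hypothesis on min̂ bound an arbitrary feasible set.

module Submission where

open import Defs
open import Data.Bool using (Bool; true; false; _∧_; _∨_; not)
import Data.Bool as B
open import Data.Bool.Properties using (∧-identityʳ; ∨-identityʳ; ∨-zeroʳ; not-¬; ¬-not)
open import Data.List using ([]; _∷_; _++_; map; filter; length)
open import Data.List.Properties using (filter-++; length-++)
open import Data.Nat using (ℕ; zero; suc; _+_; _≤_; _<_; _∸_; _%_; _≤?_; z≤n; s≤s)
import Data.Nat as ℕ
open import Data.Nat.Properties
  using (+-identityʳ; +-suc; +-mono-≤; ≤-refl; ≤-trans; ≤-pred; <-≤-trans; ≰⇒>; suc-injective;
         m+n≡0⇒m≡0; m+n≡0⇒n≡0; n≤0⇒n≡0; n≢0⇒n>0)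
open import Data.Product using (Σ; ∃; _×_; _,_; proj₁; proj₂)
open import Data.Sum using (_⊎_; inj₁; inj₂; [_,_]′)
open import Function using (_∘_; id)
open import Relation.Binary.Definitions using (DecidableEquality)
open import Relation.Binary.PropositionalEquality
open import Relation.Nullary using (¬_; yes; no; does; contradiction)
open import Relation.Nullary.Decidable using (map′; dec-true; dec-false)
open import Relation.Unary using (Pred)
import Relation.Unary as U

open ≡-Reasoning

∧≡true⇒ : ∀ {a b} → a ∧ b ≡ true → a ≡ true × b ≡ true
∧≡true⇒ {true} {true} refl = refl , refl

∨≡true⇒ : ∀ {a b} → a ∨ b ≡ true → a ≡ true ⊎ b ≡ true
∨≡true⇒ {true} refl = inj₁ refl
∨≡true⇒ {false} b≡true = inj₂ b≡true

∧-not-intro : ∀ {a b} → a ≡ true → b ≡ false → a ∧ not b ≡ true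
∧-not-intro refl refl = refl

∧-not-elim : ∀ {a b} → a ∧ not b ≡ true → a ≡ true × b ≡ false
∧-not-elim {true} {false} refl = refl , refl

∧-not-∨ : ∀ a b c → (a ∧ not b) ∧ not c ≡ a ∧ not (b ∨ c)
∧-not-∨ true true  c = refl
∧-not-∨ true false c = refl
∧-not-∨ false b    c = refl

∨-introˡ : ∀ {a b} → a ≡ true → a ∨ b ≡ true
∨-introˡ refl = refl

∨-introʳ : ∀ {a b} → b ≡ true → a ∨ b ≡ true
∨-introʳ {a} refl = ∨-zeroʳ a

left-injective : ∀ {lab l r} {x y : Vtx l} → left {lab} {l} {r} x ≡ left y → x ≡ y
left-injective refl = refl

right-injective : ∀ {lab l r} {x y : Vtx r} → right {lab} {l} {r} x ≡ right y → x ≡ y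
right-injective refl = refl

_≟ᵥ_ : ∀ {t} → DecidableEquality (Vtx t)
here    ≟ᵥ here    = yes refl
left x  ≟ᵥ left y  = map′ (cong left) left-injective (x ≟ᵥ y)
right x ≟ᵥ right y = map′ (cong right) right-injective (x ≟ᵥ y)
left x  ≟ᵥ right y = no λ ()
right x ≟ᵥ left y  = no λ ()

Adj-sym : ∀ t {x y} → Adj t x y → Adj t y x
Adj-sym leaf         {here}    {here}    ()
Adj-sym (node _ l r) {left x}  {left y}  = Adj-sym l
Adj-sym (node _ l r) {right x} {right y} = Adj-sym r
Adj-sym (node _ l r) {left x}  {right y} a = a
Adj-sym (node _ l r) {right x} {left y}  a = a

Adj-irrefl : ∀ t {x} → ¬ Adj t x x
Adj-irrefl leaf {here} ()
Adj-irrefl (node _ l r) {left x}  = Adj-irrefl l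
Adj-irrefl (node _ l r) {right x} = Adj-irrefl r

anyVtx : (t : Tree) → (Vtx t → Bool) → Bool
anyVtx leaf         p = p here
anyVtx (node _ l r) p = anyVtx l (p ∘ left) ∨ anyVtx r (p ∘ right)

anyVtx-witness : ∀ t {p} → anyVtx t p ≡ true → ∃ λ z → p z ≡ true
anyVtx-witness leaf e = here , e
anyVtx-witness (node _ l r) e with ∨≡true⇒ e
... | inj₁ eˡ = let z , pz = anyVtx-witness l eˡ in left z , pz
... | inj₂ eʳ = let z , pz = anyVtx-witness r eʳ in right z , pz

anyVtx-intro : ∀ t {p} z → p z ≡ true → anyVtx t p ≡ true
anyVtx-intro leaf         here      pz = pz
anyVtx-intro (node _ l r) (left x)  pz = ∨-introˡ (anyVtx-intro l x pz)
anyVtx-intro (node _ l r) (right y) pz = ∨-introʳ (anyVtx-intro r y pz)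

module _ {t : Tree} where

  infixl 6 _∖_ _-_
  infixl 7 _∪_
  infix 4 _⊆_ _≐_

  ∅ : Subset t
  ∅ _ = false

  _∪_ _∖_ : Subset t → Subset t → Subset t
  (A ∪ B) z = A z ∨ B z
  (A ∖ B) z = A z ∧ not (B z)

  ⁅_⁆ : Vtx t → Subset t
  ⁅ x ⁆ z = does (z ≟ᵥ x)

  _-_ : Subset t → Vtx t → Subset t
  A - x = A ∖ ⁅ x ⁆

  _⊆_ _≐_ Disjoint : Subset t → Subset t → Set
  A ⊆ B = ∀ z → A z ≡ true → B z ≡ true
  A ≐ B = ∀ z → A z ≡ B z
  Disjoint A B = ∀ z → A z ≡ true → B z ≡ false

  ⁅⁆-refl : ∀ x → ⁅ x ⁆ x ≡ true
  ⁅⁆-refl x = dec-true (x ≟ᵥ x) refl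

  ⁅⁆-sound : ∀ x z → ⁅ x ⁆ z ≡ true → z ≡ x
  ⁅⁆-sound x z e with z ≟ᵥ x
  ... | yes z≡x = z≡x

  ⁅⁆-other : ∀ {x z} → z ≢ x → ⁅ x ⁆ z ≡ false
  ⁅⁆-other {x} {z} = dec-false (z ≟ᵥ x)

[_,_]ₛ : ∀ {lab l r} → Subset l → Subset r → Subset (node lab l r)
[ A , B ]ₛ (left x)  = A x
[ A , B ]ₛ (right y) = B y

length-filter-map : ∀ {a b p} {V : Set a} {W : Set b} {P : Pred W p} (P? : U.Decidable P) (f : V → W) xs →
  length (filter P? (map f xs)) ≡ length (filter (P? ∘ f) xs)
length-filter-map P? f []       = refl
length-filter-map P? f (x ∷ xs) with does (P? (f x))
... | true  = cong suc (length-filter-map P? f xs)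
... | false = length-filter-map P? f xs

∣∣ₛ-node : ∀ {lab l r} (A : Subset (node lab l r)) → ∣ A ∣ₛ ≡ ∣ A ∘ left ∣ₛ + ∣ A ∘ right ∣ₛ
∣∣ₛ-node {l = l} {r} A = begin
  length (filter A? (map left (allV l) ++ map right (allV r)))
    ≡⟨ cong length (filter-++ A? (map left (allV l)) _) ⟩
  length (filter A? (map left (allV l)) ++ filter A? (map right (allV r)))
    ≡⟨ length-++ (filter A? (map left (allV l))) ⟩
  length (filter A? (map left (allV l))) + length (filter A? (map right (allV r)))
    ≡⟨ cong₂ _+_ (length-filter-map A? left (allV l)) (length-filter-map A? right (allV r)) ⟩
  ∣ A ∘ left ∣ₛ + ∣ A ∘ right ∣ₛ ∎
  where
  A? = λ z → A z B.≟ true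

∣∣ₛ-cong : ∀ {t} {A B : Subset t} → A ≐ B → ∣ A ∣ₛ ≡ ∣ B ∣ₛ
∣∣ₛ-cong {leaf} {A} {B} A≐B with A here | B here | A≐B here
... | true  | true  | refl = refl
... | false | false | refl = refl
∣∣ₛ-cong {node _ l r} {A} {B} A≐B = begin
  ∣ A ∣ₛ                         ≡⟨ ∣∣ₛ-node A ⟩
  ∣ A ∘ left ∣ₛ + ∣ A ∘ right ∣ₛ ≡⟨ cong₂ _+_ (∣∣ₛ-cong (A≐B ∘ left)) (∣∣ₛ-cong (A≐B ∘ right)) ⟩
  ∣ B ∘ left ∣ₛ + ∣ B ∘ right ∣ₛ ≡⟨ ∣∣ₛ-node B ⟨
  ∣ B ∣ₛ                         ∎

∣∣ₛ-mono : ∀ {t} {A B : Subset t} → A ⊆ B → ∣ A ∣ₛ ≤ ∣ B ∣ₛ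
∣∣ₛ-mono {leaf} {A} A⊆B with A here in Ah
... | false = z≤n
... | true rewrite A⊆B here Ah = ≤-refl
∣∣ₛ-mono {node _ l r} {A} {B} A⊆B
  rewrite ∣∣ₛ-node A | ∣∣ₛ-node B = +-mono-≤ (∣∣ₛ-mono (A⊆B ∘ left)) (∣∣ₛ-mono (A⊆B ∘ right))

∣∅∣ₛ : ∀ t → ∣ ∅ {t} ∣ₛ ≡ 0
∣∅∣ₛ leaf = refl
∣∅∣ₛ (node lab l r) rewrite ∣∣ₛ-node {lab} {l} {r} ∅ | ∣∅∣ₛ l | ∣∅∣ₛ r = refl

∣∣ₛ≡0⇒empty : ∀ {t} {A : Subset t} → ∣ A ∣ₛ ≡ 0 → A ≐ ∅
∣∣ₛ≡0⇒empty {leaf} {A} e here with A here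
... | false = refl
∣∣ₛ≡0⇒empty {node _ l r} {A} e (left x) =
  ∣∣ₛ≡0⇒empty (m+n≡0⇒m≡0 _ (trans (sym (∣∣ₛ-node A)) e)) x
∣∣ₛ≡0⇒empty {node _ l r} {A} e (right y) =
  ∣∣ₛ≡0⇒empty (m+n≡0⇒n≡0 ∣ A ∘ left ∣ₛ (trans (sym (∣∣ₛ-node A)) e)) y

∣∣ₛ>0⇒nonempty : ∀ {t} {A : Subset t} → 0 < ∣ A ∣ₛ → ∃ λ z → A z ≡ true
∣∣ₛ>0⇒nonempty {leaf} {A} _ with A here in Ah
... | true = here , Ah
∣∣ₛ>0⇒nonempty {node _ l r} {A} 0<∣A∣ with ∣ A ∘ left ∣ₛ in eq | ∣∣ₛ-node A
... | suc _ | _ = let x , Ax = ∣∣ₛ>0⇒nonempty (subst (0 <_) (sym eq) (s≤s z≤n)) in left x , Ax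
... | zero  | e = let y , Ay = ∣∣ₛ>0⇒nonempty (subst (0 <_) e 0<∣A∣) in right y , Ay

∣∣ₛ-remove : ∀ {t} (A : Subset t) {x} → A x ≡ true → ∣ A ∣ₛ ≡ suc ∣ A - x ∣ₛ
∣∣ₛ-remove {leaf} A {here} Ax rewrite Ax = refl
∣∣ₛ-remove {node _ l r} A {left x} Ax = begin
  ∣ A ∣ₛ
    ≡⟨ ∣∣ₛ-node A ⟩
  ∣ A ∘ left ∣ₛ + ∣ A ∘ right ∣ₛ
    ≡⟨ cong₂ _+_ (∣∣ₛ-remove (A ∘ left) Ax) (∣∣ₛ-cong (sym ∘ ∧-identityʳ ∘ A ∘ right)) ⟩
  suc (∣ (A - left x) ∘ left ∣ₛ + ∣ (A - left x) ∘ right ∣ₛ)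
    ≡⟨ cong suc (∣∣ₛ-node (A - left x)) ⟨
  suc ∣ A - left x ∣ₛ ∎
∣∣ₛ-remove {node _ l r} A {right y} Ay = begin
  ∣ A ∣ₛ
    ≡⟨ ∣∣ₛ-node A ⟩
  ∣ A ∘ left ∣ₛ + ∣ A ∘ right ∣ₛ
    ≡⟨ cong₂ _+_ (∣∣ₛ-cong (sym ∘ ∧-identityʳ ∘ A ∘ left)) (∣∣ₛ-remove (A ∘ right) Ay) ⟩
  ∣ (A - right y) ∘ left ∣ₛ + suc ∣ (A - right y) ∘ right ∣ₛ
    ≡⟨ +-suc _ _ ⟩
  suc (∣ (A - right y) ∘ left ∣ₛ + ∣ (A - right y) ∘ right ∣ₛ)
    ≡⟨ cong suc (∣∣ₛ-node (A - right y)) ⟨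
  suc ∣ A - right y ∣ₛ ∎

module _ {t : Tree} where

  matching-≐ : ∀ {A B : Subset t} → A ≐ B → HasPerfectMatching t A → HasPerfectMatching t B
  matching-≐ {A} {B} A≐B (M , M⊆Adj , M-sym , M-partner) = M , M⊆Adj′ , M-sym , M-partner′
    where
    M⊆Adj′ : ∀ x y → M x y ≡ true → B x ≡ true × B y ≡ true × Adj t x y
    M⊆Adj′ x y e = let Ax , Ay , adj = M⊆Adj x y e in trans (sym (A≐B x)) Ax , trans (sym (A≐B y)) Ay , adj
    M-partner′ : ∀ x → B x ≡ true → Σ (Vtx t) λ y → M x y ≡ true × (∀ z → M x z ≡ true → z ≡ y)
    M-partner′ x Bx = M-partner x (trans (A≐B x) Bx)

  matching-unique : ∀ {A} (pm : HasPerfectMatching t A) {x y z} →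
                    proj₁ pm x y ≡ true → proj₁ pm x z ≡ true → y ≡ z
  matching-unique (_ , M⊆Adj , _ , M-partner) Mxy Mxz =
    let _ , _ , uniq = M-partner _ (proj₁ (M⊆Adj _ _ Mxy)) in trans (uniq _ Mxy) (sym (uniq _ Mxz))

  matching-∪ : ∀ {A B} → Disjoint A B → HasPerfectMatching t A → HasPerfectMatching t B →
               HasPerfectMatching t (A ∪ B)
  matching-∪ {A} {B} A∩B≡∅ (Ma , Ma⊆Adj , Ma-sym , Ma-partner) (Mb , Mb⊆Adj , Mb-sym , Mb-partner) =
    M , M⊆Adj , M-sym , M-partner
    where
    M : Vtx t → Vtx t → Bool
    M x y = Ma x y ∨ Mb x y
    M⊆Adj : ∀ x y → M x y ≡ true → (A ∪ B) x ≡ true × (A ∪ B) y ≡ true × Adj t x y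
    M⊆Adj x y e with ∨≡true⇒ e
    ... | inj₁ Maxy = let Ax , Ay , adj = Ma⊆Adj x y Maxy in ∨-introˡ Ax , ∨-introˡ Ay , adj
    ... | inj₂ Mbxy = let Bx , By , adj = Mb⊆Adj x y Mbxy in ∨-introʳ Bx , ∨-introʳ By , adj
    M-sym : ∀ x y → M x y ≡ true → M y x ≡ true
    M-sym x y e with ∨≡true⇒ e
    ... | inj₁ Maxy = ∨-introˡ (Ma-sym x y Maxy)
    ... | inj₂ Mbxy = ∨-introʳ (Mb-sym x y Mbxy)
    M-partner : ∀ x → (A ∪ B) x ≡ true → Σ (Vtx t) λ y → M x y ≡ true × (∀ z → M x z ≡ true → z ≡ y)
    M-partner x e with A x in Ax
    ... | true = let y , Maxy , uniq = Ma-partner x Ax in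
      y , ∨-introˡ Maxy , λ z Mxz →
        [ uniq z , (λ Mbxz → contradiction (A∩B≡∅ x Ax) (not-¬ (proj₁ (Mb⊆Adj x z Mbxz)))) ]′ (∨≡true⇒ Mxz)
    ... | false = let y , Mbxy , uniq = Mb-partner x e in
      y , ∨-introʳ Mbxy , λ z Mxz →
        [ (λ Maxz → contradiction Ax (not-¬ (proj₁ (Ma⊆Adj x z Maxz)))) , uniq z ]′ (∨≡true⇒ Mxz)

  matching-edge : ∀ {x y} → Adj t x y → HasPerfectMatching t (⁅ x ⁆ ∪ ⁅ y ⁆)
  matching-edge {x} {y} adj = M , M⊆Adj , M-sym , M-partner
    where
    x≢y : x ≢ y
    x≢y refl = Adj-irrefl t adj
    M : Vtx t → Vtx t → Bool
    M u v = ⁅ x ⁆ u ∧ ⁅ y ⁆ v ∨ ⁅ y ⁆ u ∧ ⁅ x ⁆ v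
    M-view : ∀ {u v} → M u v ≡ true → u ≡ x × v ≡ y ⊎ u ≡ y × v ≡ x
    M-view {u} e with ∨≡true⇒ {⁅ x ⁆ u ∧ _} e
    ... | inj₁ e′ = let u∈x , v∈y = ∧≡true⇒ e′ in inj₁ (⁅⁆-sound x _ u∈x , ⁅⁆-sound y _ v∈y)
    ... | inj₂ e′ = let u∈y , v∈x = ∧≡true⇒ e′ in inj₂ (⁅⁆-sound y _ u∈y , ⁅⁆-sound x _ v∈x)
    Mxy : M x y ≡ true
    Mxy = ∨-introˡ (cong₂ _∧_ (⁅⁆-refl x) (⁅⁆-refl y))
    Myx : M y x ≡ true
    Myx = ∨-introʳ (cong₂ _∧_ (⁅⁆-refl y) (⁅⁆-refl x))
    M⊆Adj : ∀ u v → M u v ≡ true → (⁅ x ⁆ ∪ ⁅ y ⁆) u ≡ true × (⁅ x ⁆ ∪ ⁅ y ⁆) v ≡ true × Adj t u v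
    M⊆Adj u v e with M-view {u} {v} e
    ... | inj₁ (refl , refl) = ∨-introˡ (⁅⁆-refl x) , ∨-introʳ (⁅⁆-refl y) , adj
    ... | inj₂ (refl , refl) = ∨-introʳ (⁅⁆-refl y) , ∨-introˡ (⁅⁆-refl x) , Adj-sym t adj
    M-sym : ∀ u v → M u v ≡ true → M v u ≡ true
    M-sym u v e with M-view {u} {v} e
    ... | inj₁ (refl , refl) = Myx
    ... | inj₂ (refl , refl) = Mxy
    M-partner : ∀ u → (⁅ x ⁆ ∪ ⁅ y ⁆) u ≡ true →
                Σ (Vtx t) λ v → M u v ≡ true × (∀ z → M u z ≡ true → z ≡ v)
    M-partner u e with ∨≡true⇒ {⁅ x ⁆ u} e
    ... | inj₁ u∈x with refl ← ⁅⁆-sound x u u∈x =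
      y , Mxy , λ z Mxz → [ proj₂ , (λ (x≡y , _) → contradiction x≡y x≢y) ]′ (M-view Mxz)
    ... | inj₂ u∈y with refl ← ⁅⁆-sound y u u∈y =
      x , Myx , λ z Myz → [ (λ (y≡x , _) → contradiction (sym y≡x) x≢y) , proj₂ ]′ (M-view Myz)

matching-join : ∀ {lab l r} {A : Subset l} {B : Subset r} →
                HasPerfectMatching l A → HasPerfectMatching r B →
                HasPerfectMatching (node lab l r) [ A , B ]ₛ
matching-join {lab} {l} {r} {A} {B}
              (Ma , Ma⊆Adj , Ma-sym , Ma-partner) (Mb , Mb⊆Adj , Mb-sym , Mb-partner) =
  M , M⊆Adj , M-sym , M-partner
  where
  V = Vtx (node lab l r)
  M : V → V → Bool
  M (left x)  (left y)  = Ma x y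
  M (right x) (right y) = Mb x y
  M _         _         = false
  M⊆Adj : ∀ x y → M x y ≡ true → [ A , B ]ₛ x ≡ true × [ A , B ]ₛ y ≡ true × Adj (node lab l r) x y
  M⊆Adj (left x)  (left y)  = Ma⊆Adj x y
  M⊆Adj (right x) (right y) = Mb⊆Adj x y
  M-sym : ∀ x y → M x y ≡ true → M y x ≡ true
  M-sym (left x)  (left y)  = Ma-sym x y
  M-sym (right x) (right y) = Mb-sym x y
  M-partner : ∀ x → [ A , B ]ₛ x ≡ true → Σ V λ y → M x y ≡ true × (∀ z → M x z ≡ true → z ≡ y)
  M-partner (left x) Ax =
    let y , Mxy , uniq = Ma-partner x Ax in left y , Mxy , λ { (left z) Mxz → cong left (uniq z Mxz) }
  M-partner (right x) Bx =
    let y , Mxy , uniq = Mb-partner x Bx in right y , Mxy , λ { (right z) Mxz → cong right (uniq z Mxz) }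

module _ {lab : Label} {l r : Tree} where

  crossingˡ : (Vtx (node lab l r) → Vtx (node lab l r) → Bool) → Subset l
  crossingˡ M x = anyVtx r λ y → M (left x) (right y)

  crossingʳ : (Vtx (node lab l r) → Vtx (node lab l r) → Bool) → Subset r
  crossingʳ M y = anyVtx l λ x → M (right y) (left x)

  matching-restrictˡ : ∀ {A} (pm : HasPerfectMatching (node lab l r) A) →
                       HasPerfectMatching l (A ∘ left ∖ crossingˡ (proj₁ pm))
  matching-restrictˡ {A} pm@(M , M⊆Adj , M-sym , M-partner) = Mˡ , Mˡ⊆Adj , Mˡ-sym , Mˡ-partner
    where
    Mˡ : Vtx l → Vtx l → Bool
    Mˡ x y = M (left x) (left y)
    uncrossed : ∀ {x y} → Mˡ x y ≡ true → crossingˡ M x ≡ false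
    uncrossed Mxy = ¬-not λ crossed →
      let _ , Mxz = anyVtx-witness r crossed in contradiction (matching-unique pm Mxy Mxz) λ ()
    Mˡ⊆Adj : ∀ x y → Mˡ x y ≡ true →
             (A ∘ left ∖ crossingˡ M) x ≡ true × (A ∘ left ∖ crossingˡ M) y ≡ true × Adj l x y
    Mˡ⊆Adj x y Mxy = let Ax , Ay , adj = M⊆Adj _ _ Mxy in
      ∧-not-intro Ax (uncrossed Mxy) , ∧-not-intro Ay (uncrossed (M-sym _ _ Mxy)) , adj
    Mˡ-sym : ∀ x y → Mˡ x y ≡ true → Mˡ y x ≡ true
    Mˡ-sym x y = M-sym (left x) (left y)
    Mˡ-partner : ∀ x → (A ∘ left ∖ crossingˡ M) x ≡ true →
                 Σ (Vtx l) λ y → Mˡ x y ≡ true × (∀ z → Mˡ x z ≡ true → z ≡ y)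
    Mˡ-partner x e with ∧-not-elim e
    ... | Ax , uncrossed-x with M-partner (left x) Ax
    ... | left y  , Mxy , uniq = y , Mxy , λ z Mxz → left-injective (uniq (left z) Mxz)
    ... | right y , Mxy , _    = contradiction (anyVtx-intro r y Mxy) (not-¬ uncrossed-x)

  matching-restrictʳ : ∀ {A} (pm : HasPerfectMatching (node lab l r) A) →
                       HasPerfectMatching r (A ∘ right ∖ crossingʳ (proj₁ pm))
  matching-restrictʳ {A} pm@(M , M⊆Adj , M-sym , M-partner) = Mʳ , Mʳ⊆Adj , Mʳ-sym , Mʳ-partner
    where
    Mʳ : Vtx r → Vtx r → Bool
    Mʳ x y = M (right x) (right y)
    uncrossed : ∀ {x y} → Mʳ x y ≡ true → crossingʳ M x ≡ false
    uncrossed Mxy = ¬-not λ crossed →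
      let _ , Mxz = anyVtx-witness l crossed in contradiction (matching-unique pm Mxy Mxz) λ ()
    Mʳ⊆Adj : ∀ x y → Mʳ x y ≡ true →
             (A ∘ right ∖ crossingʳ M) x ≡ true × (A ∘ right ∖ crossingʳ M) y ≡ true × Adj r x y
    Mʳ⊆Adj x y Mxy = let Ax , Ay , adj = M⊆Adj _ _ Mxy in
      ∧-not-intro Ax (uncrossed Mxy) , ∧-not-intro Ay (uncrossed (M-sym _ _ Mxy)) , adj
    Mʳ-sym : ∀ x y → Mʳ x y ≡ true → Mʳ y x ≡ true
    Mʳ-sym x y = M-sym (right x) (right y)
    Mʳ-partner : ∀ x → (A ∘ right ∖ crossingʳ M) x ≡ true →
                 Σ (Vtx r) λ y → Mʳ x y ≡ true × (∀ z → Mʳ x z ≡ true → z ≡ y)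
    Mʳ-partner x e with ∧-not-elim e
    ... | Ax , uncrossed-x with M-partner (right x) Ax
    ... | right y , Mxy , uniq = y , Mxy , λ z Mxz → right-injective (uniq (right z) Mxz)
    ... | left y  , Mxy , _    = contradiction (anyVtx-intro l y Mxy) (not-¬ uncrossed-x)

module _ {t : Tree} where

  add-pair : ∀ {S X Y : Subset t} {x y} →
             S x ≡ true → S y ≡ true → X x ≡ true → Y y ≡ true → Disjoint X Y →
             (S ∖ (X ∪ Y)) ∪ (⁅ x ⁆ ∪ ⁅ y ⁆) ≐ S ∖ ((X - x) ∪ (Y - y))
  add-pair {S} {X} {Y} {x} {y} Sx Sy Xx Yy X∩Y≡∅ z with z ≟ᵥ x | z ≟ᵥ y
  ... | yes refl | _      rewrite Sx | Xx | X∩Y≡∅ x Xx = refl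
  ... | no _     | yes refl rewrite Sy | Yy | ¬-not {X y} (λ Xy → not-¬ Yy (X∩Y≡∅ y Xy)) = refl
  ... | no _     | no _   rewrite ∧-identityʳ (X z) | ∧-identityʳ (Y z) = ∨-identityʳ _

  pair-off : ∀ n {S X Y : Subset t} → ∣ Y ∣ₛ ≡ n → n ≤ ∣ X ∣ₛ → X ⊆ S → Y ⊆ S → Disjoint X Y →
             (∀ x y → X x ≡ true → Y y ≡ true → Adj t x y) →
             HasPerfectMatching t (S ∖ (X ∪ Y)) →
             ∃ λ X′ → X′ ⊆ X × ∣ X′ ∣ₛ + n ≡ ∣ X ∣ₛ × HasPerfectMatching t (S ∖ X′)
  pair-off zero {S} {X} {Y} ∣Y∣≡0 _ _ _ _ _ pm = X , (λ _ → id) , +-identityʳ _ , matching-≐ drop-Y pm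
    where
    drop-Y : S ∖ (X ∪ Y) ≐ S ∖ X
    drop-Y z rewrite ∣∣ₛ≡0⇒empty ∣Y∣≡0 z | ∨-identityʳ (X z) = refl
  pair-off (suc n) {S} {X} {Y} ∣Y∣≡1+n 1+n≤∣X∣ X⊆S Y⊆S X∩Y≡∅ X×Y⊆Adj pm
    with y , Yy ← ∣∣ₛ>0⇒nonempty (subst (0 <_) (sym ∣Y∣≡1+n) (s≤s z≤n))
       | x , Xx ← ∣∣ₛ>0⇒nonempty (<-≤-trans (s≤s z≤n) 1+n≤∣X∣)
    = let X′ , X′⊆X-x , ∣X′∣+n≡∣X-x∣ , pm′ = paired-rest
      in X′ , (λ z → proj₁ ∘ ∧-not-elim ∘ X′⊆X-x z) ,
         trans (+-suc _ n) (trans (cong suc ∣X′∣+n≡∣X-x∣) (sym (∣∣ₛ-remove X Xx))) , pm′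
    where
    S∖X∪Y∩xy≡∅ : Disjoint (S ∖ (X ∪ Y)) (⁅ x ⁆ ∪ ⁅ y ⁆)
    S∖X∪Y∩xy≡∅ z e = cong₂ _∨_ (⁅⁆-other z≢x) (⁅⁆-other z≢y)
      where
      z∉X∪Y = proj₂ (∧-not-elim e)
      z≢x : z ≢ x
      z≢x refl = not-¬ (∨-introˡ {b = Y x} Xx) z∉X∪Y
      z≢y : z ≢ y
      z≢y refl = not-¬ (∨-introʳ {a = X y} Yy) z∉X∪Y
    X-x∩Y-y≡∅ : Disjoint (X - x) (Y - y)
    X-x∩Y-y≡∅ z Xz rewrite X∩Y≡∅ z (proj₁ (∧-not-elim Xz)) = refl
    paired-rest : ∃ λ X′ → X′ ⊆ X - x × ∣ X′ ∣ₛ + n ≡ ∣ X - x ∣ₛ × HasPerfectMatching t (S ∖ X′)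
    paired-rest = pair-off n
      (suc-injective (trans (sym (∣∣ₛ-remove Y Yy)) ∣Y∣≡1+n))
      (≤-pred (subst (suc n ≤_) (∣∣ₛ-remove X Xx) 1+n≤∣X∣))
      (λ z → X⊆S z ∘ proj₁ ∘ ∧-not-elim) (λ z → Y⊆S z ∘ proj₁ ∘ ∧-not-elim) X-x∩Y-y≡∅
      (λ z w Xz Yw → X×Y⊆Adj z w (proj₁ (∧-not-elim Xz)) (proj₁ (∧-not-elim Yw)))
      (matching-≐ (add-pair (X⊆S x Xx) (Y⊆S y Yy) Xx Yy X∩Y≡∅)
        (matching-∪ S∖X∪Y∩xy≡∅ pm (matching-edge (X×Y⊆Adj x y Xx Yy))))

Feasible⇒≤tsSize : ∀ {t k S} → Feasible t k S → k ≤ tsSize t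
Feasible⇒≤tsSize (_ , _ , X⊆S∩TS , refl , _) = ∣∣ₛ-mono (λ z → proj₂ ∘ X⊆S∩TS z)

module _ {l r : Tree} where

  split-⊕ˡ : ∀ {k S} → Feasible (node at⊕ l r) k S → ∃ λ kˡ → Feasible l kˡ (S ∘ left)
  split-⊕ˡ {S = S} (dominated , X , X⊆S∩TS , _ , pm) =
    _ , dominatedˡ , Xˡ , Xˡ⊆S∩TS , refl ,
    matching-≐ (λ x → ∧-not-∨ (S (left x)) (X (left x)) (crossingˡ (proj₁ pm) x)) (matching-restrictˡ pm)
    where
    Xˡ : Subset l
    Xˡ = X ∘ left ∪ crossingˡ (proj₁ pm)
    dominatedˡ : ∀ x → TS l x ≡ false → InClosedNbhd l (S ∘ left) x
    dominatedˡ x x∉TS with dominated (left x) x∉TS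
    ... | inj₁ Sx                    = inj₁ Sx
    ... | inj₂ (left y , Sy , adj)   = inj₂ (y , Sy , adj)
    ... | inj₂ (right _ , _ , x∈TS , _) = contradiction x∈TS (not-¬ x∉TS)
    Xˡ⊆S∩TS : ∀ x → Xˡ x ≡ true → S (left x) ≡ true × TS l x ≡ true
    Xˡ⊆S∩TS x e with ∨≡true⇒ {X (left x)} e
    ... | inj₁ Xx      = X⊆S∩TS (left x) Xx
    ... | inj₂ crossed =
      let _ , Mxy = anyVtx-witness r crossed
          S∖Xx , _ , x∈TS , _ = proj₁ (proj₂ pm) _ _ Mxy
      in proj₁ (∧-not-elim S∖Xx) , x∈TS

  split-⊕ʳ : ∀ {k S} → Feasible (node at⊕ l r) k S → ∃ λ kʳ → Feasible r kʳ (S ∘ right)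
  split-⊕ʳ {S = S} (dominated , X , X⊆S∩TS , _ , pm) =
    _ , dominatedʳ , crossingʳ (proj₁ pm) , Xʳ⊆S∩TS , refl , matching-≐ X∘right≐∅ (matching-restrictʳ pm)
    where
    dominatedʳ : ∀ y → TS r y ≡ false → InClosedNbhd r (S ∘ right) y
    dominatedʳ y y∉TS with dominated (right y) refl
    ... | inj₁ Sy                       = inj₁ Sy
    ... | inj₂ (right z , Sz , adj)     = inj₂ (z , Sz , adj)
    ... | inj₂ (left _ , _ , _ , y∈TS) = contradiction y∈TS (not-¬ y∉TS)
    X∘right≐∅ : S ∘ right ∖ X ∘ right ∖ crossingʳ (proj₁ pm) ≐ S ∘ right ∖ crossingʳ (proj₁ pm)
    X∘right≐∅ y rewrite ¬-not {X (right y)} (λ Xy → contradiction (proj₂ (X⊆S∩TS (right y) Xy)) λ ())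
                      | ∧-identityʳ (S (right y)) = refl
    Xʳ⊆S∩TS : ∀ y → crossingʳ (proj₁ pm) y ≡ true → S (right y) ≡ true × TS r y ≡ true
    Xʳ⊆S∩TS y crossed =
      let _ , Myx = anyVtx-witness l crossed
          S∖Xy , _ , _ , y∈TS = proj₁ (proj₂ pm) _ _ Myx
      in proj₁ (∧-not-elim S∖Xy) , y∈TS

  join-⊕ : ∀ {kˡ kʳ Sˡ Sʳ} → Feasible l kˡ Sˡ → Feasible r kʳ Sʳ → kʳ ≤ kˡ → 0 < kˡ →
           ∃ λ k → Feasible (node at⊕ l r) k [ Sˡ , Sʳ ]ₛ
  join-⊕ {kˡ} {kʳ} {Sˡ} {Sʳ} (dominatedˡ , Xˡ , Xˡ⊆Sˡ∩TS , ∣Xˡ∣≡kˡ , pmˡ)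
                             (dominatedʳ , Xʳ , Xʳ⊆Sʳ∩TS , ∣Xʳ∣≡kʳ , pmʳ) kʳ≤kˡ 0<kˡ =
    let X′ , X′⊆X , _ , pm = pair-off kʳ ∣Y∣≡kʳ kʳ≤∣X∣ (λ z → proj₁ ∘ X⊆S∩TS z) Y⊆S
                               (λ { (left _) _ → refl }) X×Y⊆Adj
                               (matching-≐ unmatched (matching-join pmˡ pmʳ))
    in ∣ X′ ∣ₛ , dominated , X′ , (λ z → X⊆S∩TS z ∘ X′⊆X z) , refl , pm
    where
    S X Y : Subset (node at⊕ l r)
    S = [ Sˡ , Sʳ ]ₛ
    X = [ Xˡ , ∅ ]ₛ
    Y = [ ∅ , Xʳ ]ₛ
    X⊆S∩TS : ∀ z → X z ≡ true → S z ≡ true × TS (node at⊕ l r) z ≡ true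
    X⊆S∩TS (left x) = Xˡ⊆Sˡ∩TS x
    Y⊆S : Y ⊆ S
    Y⊆S (right y) = proj₁ ∘ Xʳ⊆Sʳ∩TS y
    X×Y⊆Adj : ∀ x y → X x ≡ true → Y y ≡ true → Adj (node at⊕ l r) x y
    X×Y⊆Adj (left x) (right y) Xx Yy = proj₂ (Xˡ⊆Sˡ∩TS x Xx) , proj₂ (Xʳ⊆Sʳ∩TS y Yy)
    ∣Y∣≡kʳ : ∣ Y ∣ₛ ≡ kʳ
    ∣Y∣≡kʳ = trans (∣∣ₛ-node Y) (cong₂ _+_ (∣∅∣ₛ l) ∣Xʳ∣≡kʳ)
    kʳ≤∣X∣ : kʳ ≤ ∣ X ∣ₛ
    kʳ≤∣X∣ rewrite ∣∣ₛ-node X | ∣∅∣ₛ r | +-identityʳ ∣ Xˡ ∣ₛ | ∣Xˡ∣≡kˡ = kʳ≤kˡ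
    unmatched : [ Sˡ ∖ Xˡ , Sʳ ∖ Xʳ ]ₛ ≐ S ∖ (X ∪ Y)
    unmatched (left x)  = cong (λ b → Sˡ x ∧ not b) (sym (∨-identityʳ (Xˡ x)))
    unmatched (right _) = refl
    twin : ∃ λ x → Xˡ x ≡ true
    twin = ∣∣ₛ>0⇒nonempty (subst (0 <_) (sym ∣Xˡ∣≡kˡ) 0<kˡ)
    dominated : ∀ z → TS (node at⊕ l r) z ≡ false → InClosedNbhd (node at⊕ l r) S z
    dominated (left x) x∉TS with dominatedˡ x x∉TS
    ... | inj₁ Sx            = inj₁ Sx
    ... | inj₂ (y , Sy , adj) = inj₂ (left y , Sy , adj)
    dominated (right y) _ with TS r y in y∈?TS
    ... | false with dominatedʳ y y∈?TS
    ...   | inj₁ Sy            = inj₁ Sy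
    ...   | inj₂ (z , Sz , adj) = inj₂ (right z , Sz , adj)
    dominated (right y) _ | true =
      let x , Xx = twin ; Sx , x∈TS = Xˡ⊆Sˡ∩TS x Xx in inj₂ (left x , Sx , x∈TS , y∈?TS)

staircase⇒γ : ∀ {t k} → Staircase t → k ≤ tsSize t → ∃ (IsGamma t k)
staircase⇒γ {k = k} (_ , a , b , _ , _ , _ , steps) k≤∣TS∣ with steps k k≤∣TS∣ | k ≤? a | b ≤? k
... | below , _ , _ , _ | yes k≤a | _     = _ , below k≤a
... | _ , above , _ , _ | no _    | yes b≤k = _ , above b≤k
... | _ , _ , even , odd | no k≰a | no b≰k with (k ∸ a) % 2 ℕ.≟ 0
...   | yes k-a-even = _ , even (≰⇒> k≰a) (≰⇒> b≰k) k-a-even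
...   | no  k-a-odd  = _ , odd  (≰⇒> k≰a) (≰⇒> b≰k) k-a-odd

minHat≤feasible : ∀ {t mn k S} → Staircase t → IsMinHat t mn → Feasible t k S → mn ≤ ∣ S ∣ₛ
minHat≤feasible st (_ , mn≤γ) f =
  let k≤∣TS∣ = Feasible⇒≤tsSize f ; m , γ = staircase⇒γ st k≤∣TS∣
  in ≤-trans (mn≤γ _ m k≤∣TS∣ γ) (proj₂ γ _ f)

minHat≤feasible-⊕ : ∀ {l r mnˡ mnʳ k S} → Staircase l → Staircase r → IsMinHat l mnˡ → IsMinHat r mnʳ →
                Feasible (node at⊕ l r) k S → mnˡ + mnʳ ≤ ∣ S ∣ₛ
minHat≤feasible-⊕ {S = S} stˡ stʳ minˡ minʳ f =
  subst (_ ≤_) (sym (∣∣ₛ-node S))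
    (+-mono-≤ (minHat≤feasible stˡ minˡ (proj₂ (split-⊕ˡ f)))
              (minHat≤feasible stʳ minʳ (proj₂ (split-⊕ʳ f))))

lemma29 : (l r : Tree) → Staircase l → Staircase r →
    (mnl al bl mnr ar br : ℕ) →
    IsMinHat l mnl → IsAlpha l mnl al → IsBeta l mnl bl →
    IsMinHat r mnr → IsAlpha r mnr ar → IsBeta r mnr br →
    ar ≤ bl → ¬ (al ≡ 0 × br ≡ 0) → ¬ (ar ≡ 0 × bl ≡ 0) →
    IsMinHat (node at⊕ l r) (mnl + mnr)
lemma29 l r stˡ stʳ mnˡ _ bˡ mnʳ aʳ _ minˡ _ (_ , γ-bˡ , _) minʳ (_ , γ-aʳ , _) _ aʳ≤bˡ _ ¬aʳ≡bˡ≡0 =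
  let (Sˡ , fˡ , ∣Sˡ∣≡mnˡ) , _ = γ-bˡ
      (Sʳ , fʳ , ∣Sʳ∣≡mnʳ) , _ = γ-aʳ
      k , f = join-⊕ fˡ fʳ aʳ≤bˡ 0<bˡ
      ∣S∣≡mnˡ+mnʳ = trans (∣∣ₛ-node [ Sˡ , Sʳ ]ₛ) (cong₂ _+_ ∣Sˡ∣≡mnˡ ∣Sʳ∣≡mnʳ)
  in (k , Feasible⇒≤tsSize f , ([ Sˡ , Sʳ ]ₛ , f , ∣S∣≡mnˡ+mnʳ) , λ _ → lower) ,
     λ { _ _ _ ((_ , f′ , ∣S′∣≡m) , _) → subst (_ ≤_) ∣S′∣≡m (lower f′) }
  where
  lower : ∀ {k S} → Feasible (node at⊕ l r) k S → mnˡ + mnʳ ≤ ∣ S ∣ₛ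
  lower = minHat≤feasible-⊕ stˡ stʳ minˡ minʳ
  0<bˡ : 0 < bˡ
  0<bˡ = n≢0⇒n>0 λ bˡ≡0 → ¬aʳ≡bˡ≡0 (n≤0⇒n≡0 (subst (aʳ ≤_) bˡ≡0 aʳ≤bˡ) , bˡ≡0)
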